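{- Let $q$ be a prime power, let $\mathcal{F}$ be an $n\times m$ Ferrers diagram with $m\ge n$ and let $2\le d\le n$ be an integer such that $(\mathcal{F},d)$ is MDS-constructible. Let $I=\{1\le i\le m: |D_i\cap\mathcal{F}|\ge d\}=\{i_1,\dots,i_\ell\}$ and $n_{i_j}=|D_{i_j}\cap\mathcal{F}|$. Then $$|\mathrm{MC}(\mathcal{F},d)|\le\prod_{j=1}^{\ell}\binom{n_{i_j}}{n_{i_j}-d+1}_q.$$
   Context: $[i]=\{1,\dots,i\}$. An $n\times m$ Ferrers diagram is a subset $\mathcal{F}\subseteq[n]\times[m]$ such that $(1,1),(n,m)\in\mathcal{F}$; if $(i,j)\in\mathcal{F}$ and $j<m$ then $(i,j+1)\in\mathcal{F}$; and if $(i,j)\in\mathcal{F}$ and $i>1$ then $(i-1,j)\in\mathcal{F}$. Let $c_j=|\{i:(i,j)\in\mathcal{F}\}|$; $\kappa_j(\mathcal{F},d)=\sum_{t=1}^{m-d+1+j}\max\{c_t-j,0\}$ for $0\le j\le d-1$ and $\kappa(\mathcal{F},d)=\min_j\kappa_j(\mathcal{F},d)$. For $1\le i\le m+n-1$, $D_i=\{(a,b)\in[n]\times[m]: b-a=m-i\}$. $(\mathcal{F},d)$ is MDS-constructible if $\kappa(\mathcal{F},d)=\sum_{i=1}^{m+n-1}\max\{0,|D_i\cap\mathcal{F}|-d+1\}$. $\mathbb{F}_q[\mathcal{F}]$ is the space of $n\times m$ matrices over $\mathbb{F}_q$ whose entries outside $\mathcal{F}$ are zero. Construction: with $I$ and $n_i$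 as in the claim, for each $i\in I$ let $C_i\le\mathbb{F}_q^{n_i}$ be a linear MDS code of (Hamming) minimum distance $d$ (hence of dimension $n_i-d+1$). For $(x_{i_1},\dots,x_{i_\ell})\in C_{i_1}\times\dots\times C_{i_\ell}$ let $M(x_{i_1},\dots,x_{i_\ell})\in\mathbb{F}_q[\mathcal{F}]$ be the matrix having the entries of $x_{i_j}$ in the positions of $D_{i_j}\cap\mathcal{F}$ (in a fixed order) for each $j$, and zeros elsewhere; the resulting space is $\{M(x_{i_1},\dots,x_{i_\ell})\}$. $\mathrm{MC}(\mathcal{F},d)$ denotes the set of all spaces of matrices obtained in this way (over all admissible choices of the codes $C_i$). $\binom{a}{b}_q=\prod_{i=0}^{b-1}\frac{q^a-q^i}{q^b-q^i}$. -}

module Defs where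

open import Level using (0ℓ)
open import Data.Nat using (ℕ; zero; suc; _+_; _*_; _∸_; _^_; _≤_; _<_; _⊓_; _≤ᵇ_; _/_)
open import Data.Nat.Primality using (Prime)
open import Data.Fin using (Fin; toℕ)
import Data.Fin as Fin
open import Data.Nat using () renaming (_≟_ to _≟ℕ_)
open import Data.Bool using (Bool; true; false; _∧_; not; if_then_else_)
open import Data.Product using (Σ; _×_; ∃)
open import Data.Sum using (_⊎_)
open import Data.List using (List; length)
open import Data.List.Relation.Unary.All using (All)
open import Data.List.Relation.Unary.AllPairs using (AllPairs)
open import Relation.Nullary using (¬_; Dec; does)
open import Relation.Binary.PropositionalEquality using (_≡_)
open import Relation.Binary.Definitions using (DecidableEquality)
open import Algebra.Structures using (IsCommutativeRing)
open import Function.Bundles using (_↔_)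

IsPrimePower : ℕ → Set
IsPrimePower q = Σ ℕ λ p → Σ ℕ λ k → Prime p × q ≡ p ^ suc k

record FiniteField (q : ℕ) : Set₁ where
  field
    Carrier : Set
    0# 1#   : Carrier
    _⊕_ _⊗_ : Carrier → Carrier → Carrier
    ⊝_      : Carrier → Carrier
    isCommutativeRing : IsCommutativeRing _≡_ _⊕_ _⊗_ ⊝_ 0# 1#
    0≢1     : ¬ (0# ≡ 1#)
    inverse : ∀ x → ¬ (x ≡ 0#) → Σ Carrier λ y → x ⊗ y ≡ 1#
    _≟_     : DecidableEquality Carrier
    enum    : Carrier ↔ Fin q

sumFin : (k : ℕ) → (Fin k → ℕ) → ℕ
sumFin zero    f = 0
sumFin (suc k) f = f Fin.zero + sumFin k (λ i → f (Fin.suc i))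

countFin : (k : ℕ) → (Fin k → Bool) → ℕ
countFin k p = sumFin k (λ i → if p i then 1 else 0)

sumTo : ℕ → (ℕ → ℕ) → ℕ
sumTo zero    f = 0
sumTo (suc N) f = sumTo N f + f (suc N)

prodTo : ℕ → (ℕ → ℕ) → ℕ
prodTo zero    f = 1
prodTo (suc N) f = prodTo N f * f (suc N)

prodBelow : ℕ → (ℕ → ℕ) → ℕ
prodBelow zero    f = 1
prodBelow (suc b) f = prodBelow b f * f b

-- minBelow k f = min { f 0, ..., f (k - 1) }   (k ≥ 1 in all uses)
minBelow : ℕ → (ℕ → ℕ) → ℕ
minBelow zero          f = 0
minBelow (suc zero)    f = f 0
minBelow (suc (suc k)) f = minBelow (suc k) f ⊓ f (suc k)

-- natural-number division, with value 0 when dividing by 0 (never used)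
divOr : ℕ → ℕ → ℕ
divOr a zero    = 0
divOr a (suc b) = a / suc b

-- Gaussian binomial  [a choose b]_q = ∏_{i=0}^{b-1} (q^a - q^i)/(q^b - q^i),
-- written as (∏ numerators) / (∏ denominators)
qBinom : ℕ → ℕ → ℕ → ℕ
qBinom q a b = divOr (prodBelow b (λ i → q ^ a ∸ q ^ i))
                     (prodBelow b (λ i → q ^ b ∸ q ^ i))

-- Ferrers diagrams (0-based indices: row a ↔ a+1, column b ↔ b+1)

Diagram : ℕ → ℕ → Set
Diagram n m = Fin n → Fin m → Bool

record IsFerrers (n m : ℕ) (F : Diagram n m) : Set where
  field
    topLeft     : Σ (Fin n) λ a → Σ (Fin m) λ b →
                    toℕ a ≡ 0 × toℕ b ≡ 0 × F a b ≡ true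
    bottomRight : Σ (Fin n) λ a → Σ (Fin m) λ b →
                    suc (toℕ a) ≡ n × suc (toℕ b) ≡ m × F a b ≡ true
    rightClosed : ∀ a (b b' : Fin m) → toℕ b' ≡ suc (toℕ b) →
                    F a b ≡ true → F a b' ≡ true
    upClosed    : ∀ (a a' : Fin n) b → suc (toℕ a') ≡ toℕ a →
                    F a b ≡ true → F a' b ≡ true

module _ {n m : ℕ} (F : Diagram n m) where

  colCount : ℕ → ℕ
  colCount t = sumFin n λ a → countFin m λ b → F a b ∧ does (suc (toℕ b) ≟ℕ t)

  kappaJ : ℕ → ℕ → ℕ
  kappaJ d j = sumTo ((m ∸ d) + 1 + j) (λ t → colCount t ∸ j)

  kappa : ℕ → ℕ
  kappa d = minBelow d (kappaJ d)

  -- the (1-based) cell (a+1,b+1) lies on D_i with i = m - (b+1) + (a+1)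
  diagIdx : Fin n → Fin m → ℕ
  diagIdx a b = (m ∸ toℕ b) + toℕ a

  onDiag : ℕ → Fin n → Fin m → Bool
  onDiag i a b = F a b ∧ does (diagIdx a b ≟ℕ i)

  diagSize : ℕ → ℕ
  diagSize i = sumFin n λ a → countFin m λ b → onDiag i a b

  IsMDSConstructible : ℕ → Set
  IsMDSConstructible d =
    kappa d ≡ sumTo (m + n ∸ 1) (λ i → diagSize i ∸ (d ∸ 1))

  InI : ℕ → ℕ → Set
  InI d i = 1 ≤ i × i ≤ m × d ≤ diagSize i

  -- position (from 0) of the cell (a,b) inside D_i ∩ F, ordered by row
  rank : Fin n → Fin m → ℕ
  rank a b = sumFin n λ a' → countFin m λ b' →
               onDiag (diagIdx a b) a' b' ∧ (suc (toℕ a') ≤ᵇ toℕ a)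

  mcBound : ℕ → ℕ → ℕ
  mcBound q d = prodTo m λ i →
    if d ≤ᵇ diagSize i then qBinom q (diagSize i) (diagSize i ∸ d + 1) else 1

module Codes {q : ℕ} (K : FiniteField q) where
  open FiniteField K

  Word : ℕ → Set
  Word k = Fin k → Carrier

  zeroW : ∀ {k} → Word k
  zeroW _ = 0#

  IsZeroW : ∀ {k} → Word k → Set
  IsZeroW x = ∀ j → x j ≡ 0#

  weight : ∀ {k} → Word k → ℕ
  weight {k} x = countFin k λ j → not (does (x j ≟ 0#))

  linComb : ∀ {k} (r : ℕ) → (Fin r → Carrier) → (Fin r → Word k) → Word k
  linComb zero    c v j = 0#
  linComb (suc r) c v j =
    (c Fin.zero ⊗ v Fin.zero j) ⊕
    linComb r (λ i → c (Fin.suc i)) (λ i → v (Fin.suc i)) j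

  record IsLinearCode (k : ℕ) (C : Word k → Set) : Set where
    field
      zero∈ : C zeroW
      +-closed : ∀ x y → C x → C y → C (λ j → x j ⊕ y j)
      *-closed : ∀ c x → C x → C (λ j → c ⊗ x j)

  HasDimension : (k : ℕ) → (Word k → Set) → ℕ → Set
  HasDimension k C r = Σ (Fin r → Word k) λ v →
      (∀ i → C (v i))
    × (∀ c → IsZeroW (linComb r c v) → ∀ i → c i ≡ 0#)
    × (∀ x → C x → Σ (Fin r → Carrier) λ c → ∀ j → x j ≡ linComb r c v j)

  HasMinDistance : (k : ℕ) → (Word k → Set) → ℕ → Set
  HasMinDistance k C d =
      (∀ x → C x → ¬ IsZeroW x → d ≤ weight x)
    × (Σ (Word k) λ x → C x × ¬ IsZeroW x × weight x ≡ d)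

  record IsMDSCode (k d : ℕ) (C : Word k → Set) : Set where
    field
      linear   : IsLinearCode k C
      minDist  : HasMinDistance k C d
      dim      : HasDimension k C (k ∸ d + 1)

module MCDef {q : ℕ} (K : FiniteField q) {n m : ℕ} (F : Diagram n m) (d : ℕ) where
  open FiniteField K
  open Codes K

  Mat : Set
  Mat = Fin n → Fin m → Carrier

  -- a choice of a word x_i ∈ F_q^{n_i} for every i (only i ∈ I are used)
  Words : Set
  Words = (i : ℕ) → Word (diagSize F i)

  Placed : Words → Mat → Set
  Placed x M = ∀ a b →
      (F a b ≡ true → InI F d (diagIdx F a b) →
         ∀ (r : Fin (diagSize F (diagIdx F a b))) → toℕ r ≡ rank F a b →
           M a b ≡ x (diagIdx F a b) r)
    × ((F a b ≡ false ⊎ ¬ InI F d (diagIdx F a b)) → M a b ≡ 0#)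

  Space : Set₁
  Space = Mat → Set

  InMC : Space → Set₁
  InMC S = Σ ((i : ℕ) → Word (diagSize F i) → Set) λ C →
      (∀ i → InI F d i → IsMDSCode (diagSize F i) d (C i))
    × (∀ M → (S M → Σ Words λ x → (∀ i → InI F d i → C i (x i)) × Placed x M)
           × ((Σ Words λ x → (∀ i → InI F d i → C i (x i)) × Placed x M) → S M))

  SameSpace : Space → Space → Set
  SameSpace S T = ∀ M → (S M → T M) × (T M → S M)

  -- |MC(F,d)| ≤ N : every list of pairwise distinct members has length ≤ N
  CardMC≤ : ℕ → Set₁
  CardMC≤ N = ∀ (Ss : List Space) → All InMC Ss →
    AllPairs (λ S T → ¬ SameSpace S T) Ss → length Ss ≤ N

-- A member of MC(F,d) is determined by its codes C_i, i ∈ I.  An MDS code C of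
-- length N and dimension k = N - d + 1 has no nonzero codeword vanishing on the
-- first k coordinates (its weight would be at most N - k < d), so projecting C
-- onto those coordinates is injective, hence bijective by counting.  Thus C has
-- a systematic basis [I_k | T], and C is determined by the k × (N - k) matrix T.
-- This gives at most q^(k(N-k)) MDS codes per diagonal, and
-- q^(k(N-k)) ≤ [N choose k]_q because q^(N-k) (q^k - q^i) ≤ q^N - q^i.
module Submission where

open import Defs
open import Level using (0ℓ)
open import Algebra.Bundles using (CommutativeRing)
import Algebra.Properties.AbelianGroup as AbelianGroupProperties
import Algebra.Properties.CommutativeSemigroup as CommutativeSemigroupProperties
import Algebra.Properties.Ring as RingProperties
open import Data.Bool using (Bool; true; false; not; T; if_then_else_)
open import Data.Fin as Fin using (Fin; toℕ; fromℕ<; inject≤; cast; _↑ʳ_; punchOut; funToFin; finToFun; combine)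
open import Data.Fin.Properties using (any?; all?; injective⇒≤; punchOut-injective; combine-injective; finToFun-funToFin; funToFin-finToFin; toℕ-injective; toℕ-fromℕ<; toℕ-inject≤; toℕ-cast; toℕ-↑ʳ; toℕ<n)
open import Data.List using (List; []; _∷_; length; lookup)
open import Data.List.Membership.Propositional.Properties using (∈-lookup)
import Data.List.Relation.Unary.All as All
open All using (All; []; _∷_)
open import Data.List.Relation.Unary.AllPairs using (AllPairs; []; _∷_)
open import Data.Nat using (ℕ; zero; suc; _+_; _*_; _∸_; _^_; _≤_; _<_; z≤n; s≤s; _≤ᵇ_; NonZero)
open import Data.Nat.Properties
  using (≤-refl; ≤-trans; ≤-reflexive; <⇒≱; ≮⇒≥; 1+n≰n; m≤n⇒m≤1+n; m≤n⇒m<n∨m≡n; m≤n+m;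
         _<?_; _≤?_; ≤⇒≤ᵇ; ≤ᵇ⇒≤; +-monoʳ-≤; *-mono-≤; ∸-monoˡ-<; ∸-monoʳ-≤; *-distribˡ-∸;
         m+[n∸m]≡n; m∸n+n≡m; m∸[m∸n]≡n; ∸-+-assoc; m<n⇒0<n∸m;
         ^-distribˡ-+-*; ^-monoʳ-≤; ^-monoʳ-<; m^n>0; m^n≢0; module ≤-Reasoning)
open import Data.Nat.DivMod using (_/_; /-monoˡ-≤; m*n/n≡m)
open import Data.Nat.Tactic.RingSolver using (solve-∀)
open import Data.Product using (Σ; ∃; _×_; _,_; proj₁; proj₂)
open import Data.Sum using (_⊎_; inj₁; inj₂)
open import Function.Base using (_∘_)
open import Function.Bundles using (Inverse; Injection)
open import Function.Definitions using (Injective)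
open import Function.Properties.Inverse using (↔⇒↣; ↔-sym)
open import Relation.Binary.PropositionalEquality
open import Relation.Nullary using (¬_; Dec; yes; no; does; contradiction)
open import Relation.Nullary.Decidable using (_×-dec_; dec-true)

-- Finite sets

injective⇒surjective : ∀ {M} {f : Fin M → Fin M} → Injective _≡_ _≡_ f →
                       ∀ y → ∃ λ x → f x ≡ y
injective⇒surjective {suc M} {f} f-injective y with any? (λ x → f x Fin.≟ y)
... | yes hit = hit
... | no miss = contradiction (injective⇒≤ f-avoiding-y-injective) 1+n≰n
  where
  y≢f : ∀ x → y ≢ f x
  y≢f x y≡fx = miss (x , sym y≡fx)

  f-avoiding-y : Fin (suc M) → Fin M
  f-avoiding-y x = punchOut (y≢f x)

  f-avoiding-y-injective : Injective _≡_ _≡_ f-avoiding-y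
  f-avoiding-y-injective e = f-injective (punchOut-injective (y≢f _) (y≢f _) e)

lookup-injective : ∀ {a} {A : Set a} {xs : List A} → AllPairs _≢_ xs →
                   Injective _≡_ _≡_ (lookup xs)
lookup-injective {xs = _ ∷ _} _ {Fin.zero} {Fin.zero} _ = refl
lookup-injective (x∉xs ∷ _) {Fin.zero} {Fin.suc j} x≡xⱼ =
  contradiction x≡xⱼ (All.lookup x∉xs (∈-lookup j))
lookup-injective (x∉xs ∷ _) {Fin.suc i} {Fin.zero} xᵢ≡x =
  contradiction (sym xᵢ≡x) (All.lookup x∉xs (∈-lookup i))
lookup-injective (_ ∷ distinct) {Fin.suc i} {Fin.suc j} xᵢ≡xⱼ =
  cong Fin.suc (lookup-injective distinct xᵢ≡xⱼ)

distinct⇒length≤ : ∀ {B} {xs : List (Fin B)} → AllPairs _≢_ xs → length xs ≤ B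
distinct⇒length≤ distinct = injective⇒≤ (lookup-injective distinct)

module _ {a p r} {A : Set a} {P : A → Set p} {R : A → A → Set r} {B : ℕ}
         (code : ∀ {x} → P x → Fin B)
         (code-reflects : ∀ {x y} (px : P x) (py : P y) → code px ≡ code py → R x y)
         where

  private
    codes : ∀ {xs} → All P xs → List (Fin B)
    codes []         = []
    codes (px ∷ pxs) = code px ∷ codes pxs

    length-codes : ∀ {xs} (pxs : All P xs) → length (codes pxs) ≡ length xs
    length-codes []         = refl
    length-codes (px ∷ pxs) = cong suc (length-codes pxs)

    codes-avoid : ∀ {x xs} (px : P x) (pxs : All P xs) → All (λ y → ¬ R x y) xs →
                  All (code px ≢_) (codes pxs)
    codes-avoid px []         []           = []
    codes-avoid px (py ∷ pys) (¬Rxy ∷ ¬Rs) =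
      (¬Rxy ∘ code-reflects px py) ∷ codes-avoid px pys ¬Rs

    codes-distinct : ∀ {xs} (pxs : All P xs) → AllPairs (λ x y → ¬ R x y) xs →
                     AllPairs _≢_ (codes pxs)
    codes-distinct []         []             = []
    codes-distinct (px ∷ pxs) (¬Rs ∷ ¬Rss) = codes-avoid px pxs ¬Rs ∷ codes-distinct pxs ¬Rss

  pairwiseUnrelated⇒length≤ : ∀ {xs} → All P xs → AllPairs (λ x y → ¬ R x y) xs → length xs ≤ B
  pairwiseUnrelated⇒length≤ pxs unrelated =
    subst (_≤ B) (length-codes pxs) (distinct⇒length≤ (codes-distinct pxs unrelated))

funToFin-cong : ∀ {m n} {f g : Fin m → Fin n} → (∀ i → f i ≡ g i) → funToFin f ≡ funToFin g
funToFin-cong {zero}  f≗g = refl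
funToFin-cong {suc m} f≗g = cong₂ combine (f≗g Fin.zero) (funToFin-cong (f≗g ∘ Fin.suc))

funToFin-injective : ∀ {m n} {f g : Fin m → Fin n} → funToFin f ≡ funToFin g → ∀ i → f i ≡ g i
funToFin-injective {m} {n} {f} {g} e i = begin
  f i                      ≡⟨ sym (finToFun-funToFin f i) ⟩
  finToFun (funToFin f) i  ≡⟨ cong (λ c → finToFun {n} {m} c i) e ⟩
  finToFun (funToFin g) i  ≡⟨ finToFun-funToFin g i ⟩
  g i                      ∎
  where open ≡-Reasoning

combineTo : ∀ j {f : ℕ → ℕ} → ((i : ℕ) → Fin (f i)) → Fin (prodTo j f)
combineTo zero    x = Fin.zero
combineTo (suc j) x = combine (combineTo j x) (x (suc j))

combineTo-injective : ∀ j {f : ℕ → ℕ} {x y : (i : ℕ) → Fin (f i)} →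
                      combineTo j x ≡ combineTo j y → ∀ {i} → 1 ≤ i → i ≤ j → x i ≡ y i
combineTo-injective zero    _ (s≤s _) ()
combineTo-injective (suc j) e 1≤i i≤1+j
  with combine-injective _ _ _ _ e | m≤n⇒m<n∨m≡n i≤1+j
... | same-prefix , _ | inj₁ (s≤s i≤j) = combineTo-injective j same-prefix 1≤i i≤j
... | _ , same-last   | inj₂ refl       = same-last

countFin-≤ : ∀ N (p : Fin N → Bool) → countFin N p ≤ N
countFin-≤ zero    p = z≤n
countFin-≤ (suc N) p with p Fin.zero
... | true  = s≤s (countFin-≤ N (p ∘ Fin.suc))
... | false = m≤n⇒m≤1+n (countFin-≤ N (p ∘ Fin.suc))

countFin-≤-∸ : ∀ N k (p : Fin N → Bool) → (∀ j → toℕ j < k → p j ≡ false) →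
               countFin N p ≤ N ∸ k
countFin-≤-∸ N       zero    p _        = countFin-≤ N p
countFin-≤-∸ zero    (suc k) p _        = z≤n
countFin-≤-∸ (suc N) (suc k) p p<k≡false rewrite p<k≡false Fin.zero (s≤s z≤n) =
  countFin-≤-∸ N k (p ∘ Fin.suc) (λ j j<k → p<k≡false (Fin.suc j) (s≤s j<k))

module Split {k N : ℕ} (k≤N : k ≤ N) where

  head : Fin k → Fin N
  head a = inject≤ a k≤N

  tail : Fin (N ∸ k) → Fin N
  tail b = cast (m+[n∸m]≡n k≤N) (k ↑ʳ b)

  head-fromℕ< : ∀ {j} (j<k : toℕ j < k) → head (fromℕ< j<k) ≡ j
  head-fromℕ< j<k = toℕ-injective (trans (toℕ-inject≤ _ k≤N) (toℕ-fromℕ< j<k))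

  head-or-tail : ∀ j → (∃ λ a → head a ≡ j) ⊎ (∃ λ b → tail b ≡ j)
  head-or-tail j with toℕ j <? k
  ... | yes j<k = inj₁ (_ , head-fromℕ< j<k)
  ... | no j≮k  = inj₂ (fromℕ< j-k<N-k , toℕ-injective (begin
      toℕ (tail (fromℕ< j-k<N-k))  ≡⟨ toℕ-cast _ (k ↑ʳ fromℕ< j-k<N-k) ⟩
      toℕ (k ↑ʳ fromℕ< j-k<N-k)    ≡⟨ toℕ-↑ʳ k (fromℕ< j-k<N-k) ⟩
      k + toℕ (fromℕ< j-k<N-k)     ≡⟨ cong (k +_) (toℕ-fromℕ< j-k<N-k) ⟩
      k + (toℕ j ∸ k)              ≡⟨ m+[n∸m]≡n (≮⇒≥ j≮k) ⟩
      toℕ j                        ∎))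
    where
    open ≡-Reasoning
    j-k<N-k : toℕ j ∸ k < N ∸ k
    j-k<N-k = ∸-monoˡ-< (toℕ<n j) (≮⇒≥ j≮k)

  agree-on-head-and-tail : ∀ {A : Set} {x y : Fin N → A} →
    (∀ a → x (head a) ≡ y (head a)) → (∀ b → x (tail b) ≡ y (tail b)) → ∀ j → x j ≡ y j
  agree-on-head-and-tail on-head on-tail j with head-or-tail j
  ... | inj₁ (a , refl) = on-head a
  ... | inj₂ (b , refl) = on-tail b

-- Arithmetic

prodTo-mono-≤ : ∀ j {f g : ℕ → ℕ} → (∀ i → f i ≤ g i) → prodTo j f ≤ prodTo j g
prodTo-mono-≤ zero    f≤g = ≤-refl
prodTo-mono-≤ (suc j) f≤g = *-mono-≤ (prodTo-mono-≤ j f≤g) (f≤g (suc j))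

prodBelow-mono-≤ : ∀ b {f g : ℕ → ℕ} → (∀ i → f i ≤ g i) → prodBelow b f ≤ prodBelow b g
prodBelow-mono-≤ zero    f≤g = ≤-refl
prodBelow-mono-≤ (suc b) f≤g = *-mono-≤ (prodBelow-mono-≤ b f≤g) (f≤g b)

prodBelow-*ˡ : ∀ b A (f : ℕ → ℕ) → prodBelow b (λ i → A * f i) ≡ A ^ b * prodBelow b f
prodBelow-*ˡ zero    A f = refl
prodBelow-*ˡ (suc b) A f = begin
  prodBelow b (λ i → A * f i) * (A * f b)  ≡⟨ cong (_* (A * f b)) (prodBelow-*ˡ b A f) ⟩
  A ^ b * prodBelow b f * (A * f b)        ≡⟨ regroup (A ^ b) (prodBelow b f) A (f b) ⟩
  A * A ^ b * (prodBelow b f * f b)        ∎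
  where
  open ≡-Reasoning
  regroup : ∀ x y z w → x * y * (z * w) ≡ z * x * (y * w)
  regroup = solve-∀

prodBelow-positive : ∀ b (f : ℕ → ℕ) → (∀ i → i < b → 0 < f i) → 0 < prodBelow b f
prodBelow-positive zero    f _   = s≤s z≤n
prodBelow-positive (suc b) f f>0 =
  *-mono-≤ (prodBelow-positive b f (λ i i<b → f>0 i (m≤n⇒m≤1+n i<b))) (f>0 b ≤-refl)

≤-divOr : ∀ {a b X} → 0 < b → X * b ≤ a → X ≤ divOr a b
≤-divOr {a} {suc b} {X} _ Xb≤a = subst (_≤ a / suc b) (m*n/n≡m X (suc b)) (/-monoˡ-≤ (suc b) Xb≤a)

qBinom-factor : ∀ q N k i .{{_ : NonZero q}} → k ≤ N →
                q ^ (N ∸ k) * (q ^ k ∸ q ^ i) ≤ q ^ N ∸ q ^ i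
qBinom-factor q N k i k≤N = begin
  q ^ (N ∸ k) * (q ^ k ∸ q ^ i)              ≡⟨ *-distribˡ-∸ (q ^ (N ∸ k)) (q ^ k) (q ^ i) ⟩
  q ^ (N ∸ k) * q ^ k ∸ q ^ (N ∸ k) * q ^ i  ≡⟨ cong₂ _∸_ q^N (sym (^-distribˡ-+-* q (N ∸ k) i)) ⟩
  q ^ N ∸ q ^ (N ∸ k + i)                    ≤⟨ ∸-monoʳ-≤ (q ^ N) (^-monoʳ-≤ q (m≤n+m i (N ∸ k))) ⟩
  q ^ N ∸ q ^ i                              ∎
  where
  open ≤-Reasoning
  q^N : q ^ (N ∸ k) * q ^ k ≡ q ^ N
  q^N = trans (sym (^-distribˡ-+-* q (N ∸ k) k)) (cong (q ^_) (m∸n+n≡m k≤N))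

qBinom-lower-bound : ∀ q N k → 2 ≤ q → k ≤ N → (q ^ (N ∸ k)) ^ k ≤ qBinom q N k
qBinom-lower-bound q@(suc _) N k 2≤q k≤N = ≤-divOr denominator>0
  (subst (_≤ prodBelow k (λ i → q ^ N ∸ q ^ i)) (prodBelow-*ˡ k (q ^ (N ∸ k)) _)
         (prodBelow-mono-≤ k (λ i → qBinom-factor q N k i k≤N)))
  where
  denominator>0 : 0 < prodBelow k (λ i → q ^ k ∸ q ^ i)
  denominator>0 = prodBelow-positive k _ (λ i i<k → m<n⇒0<n∸m (^-monoʳ-< q 2≤q i<k))

[m^n]^o>0 : ∀ m n o → 1 ≤ m → 0 < (m ^ n) ^ o
[m^n]^o>0 m@(suc _) n o _ = m^n>0 (m ^ n) {{m^n≢0 m n}} o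

mds-dimension≤length : ∀ {N d} → 1 ≤ d → d ≤ N → N ∸ d + 1 ≤ N
mds-dimension≤length {N} {d} 1≤d d≤N =
  ≤-trans (+-monoʳ-≤ (N ∸ d) 1≤d) (≤-reflexive (m∸n+n≡m d≤N))

mds-redundancy<d : ∀ {N d} → 1 ≤ d → d ≤ N → N ∸ (N ∸ d + 1) < d
mds-redundancy<d {N} {suc d′} _ d≤N = ≤-reflexive (cong suc (begin
  N ∸ (N ∸ suc d′ + 1)  ≡⟨ sym (∸-+-assoc N (N ∸ suc d′) 1) ⟩
  N ∸ (N ∸ suc d′) ∸ 1  ≡⟨ cong (_∸ 1) (m∸[m∸n]≡n d≤N) ⟩
  d′                    ∎))
  where open ≡-Reasoning

-- Linear algebra over a finite field

two-distinct⇒2≤ : ∀ {n} {a b : Fin n} → a ≢ b → 2 ≤ n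
two-distinct⇒2≤ {suc zero}    {Fin.zero} {Fin.zero} a≢b = contradiction refl a≢b
two-distinct⇒2≤ {suc (suc _)} _ = s≤s (s≤s z≤n)

module Linear {q : ℕ} (K : FiniteField q) where
  open FiniteField K
  open Codes K
  open Inverse enum using (to; from)

  commutativeRing : CommutativeRing 0ℓ 0ℓ
  commutativeRing = record { isCommutativeRing = isCommutativeRing }

  open CommutativeRing commutativeRing
    using (ring; +-abelianGroup; +-commutativeSemigroup; distribˡ; distribʳ; *-assoc;
           zeroʳ; *-identityʳ; +-identityˡ; +-identityʳ; -‿inverseʳ)
  open RingProperties ring using (-1*x≈-x)
  open AbelianGroupProperties +-abelianGroup using (x∙y⁻¹≈ε⇒x≈y)
  open CommutativeSemigroupProperties +-commutativeSemigroup using (interchange)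

  field-size≥2 : 2 ≤ q
  field-size≥2 = two-distinct⇒2≤ (0≢1 ∘ Injection.injective (↔⇒↣ enum))

  encodeWord : ∀ {r} → Word r → Fin (q ^ r)
  encodeWord w = funToFin (to ∘ w)

  encodeWord-injective : ∀ {r} {w w′ : Word r} → encodeWord w ≡ encodeWord w′ → ∀ j → w j ≡ w′ j
  encodeWord-injective e j = Injection.injective (↔⇒↣ enum) (funToFin-injective e j)

  decodeWord : ∀ {r} → Fin (q ^ r) → Word r
  decodeWord c = from ∘ finToFun c

  decodeWord-injective : ∀ {r} {c c′ : Fin (q ^ r)} →
                         (∀ j → decodeWord {r} c j ≡ decodeWord c′ j) → c ≡ c′
  decodeWord-injective {r} {c} {c′} e =
    trans (sym (funToFin-finToFin {r} {q} c))
          (trans (funToFin-cong {r} {q} (Injection.injective (↔⇒↣ (↔-sym enum)) ∘ e))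
                 (funToFin-finToFin {r} {q} c′))

  word-injective⇒surjective : ∀ {r} (φ : Word r → Word r) →
    (∀ {u v} → (∀ j → φ u j ≡ φ v j) → ∀ j → u j ≡ v j) →
    ∀ u → ∃ λ v → ∀ j → φ v j ≡ u j
  word-injective⇒surjective φ φ-injective u =
    let c , hit = injective⇒surjective ψ-injective (encodeWord u)
    in decodeWord c , encodeWord-injective hit
    where
    ψ-injective : Injective _≡_ _≡_ (encodeWord ∘ φ ∘ decodeWord)
    ψ-injective e = decodeWord-injective (φ-injective (encodeWord-injective e))

  -- A code is an arbitrary predicate on words, so it need not respect pointwise
  -- equality: codes are compared up to it, and subtraction is written with the
  -- scalar ⊝ 1# so that closure under scalar multiples applies verbatim.
  _⊆ᶜ_ : ∀ {r} → (Word r → Set) → (Word r → Set) → Set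
  C ⊆ᶜ C′ = ∀ {x} → C x → ∃ λ x′ → C′ x′ × ∀ j → x j ≡ x′ j

  infixl 6 _⊖_
  _⊖_ : Carrier → Carrier → Carrier
  x ⊖ y = x ⊕ ((⊝ 1#) ⊗ y)

  ⊖-self : ∀ x → x ⊖ x ≡ 0#
  ⊖-self x = trans (cong (x ⊕_) (-1*x≈-x x)) (-‿inverseʳ x)

  ⊖≡0⇒≡ : ∀ {x y} → x ⊖ y ≡ 0# → x ≡ y
  ⊖≡0⇒≡ {x} {y} e = x∙y⁻¹≈ε⇒x≈y x y (trans (cong (x ⊕_) (sym (-1*x≈-x y))) e)

  ⊖-closed : ∀ {r} {C : Word r → Set} → IsLinearCode r C →
             ∀ {x y} → C x → C y → C (λ j → x j ⊖ y j)
  ⊖-closed linear Cx Cy = +-closed _ _ Cx (*-closed (⊝ 1#) _ Cy)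
    where open IsLinearCode linear

  linComb-closed : ∀ {r} {C : Word r → Set} → IsLinearCode r C →
                   ∀ s c v → (∀ a → C (v a)) → C (linComb s c v)
  linComb-closed linear zero    c v v∈C = IsLinearCode.zero∈ linear
  linComb-closed linear (suc s) c v v∈C = +-closed _ _
      (*-closed (c Fin.zero) _ (v∈C Fin.zero))
      (linComb-closed linear s (c ∘ Fin.suc) (v ∘ Fin.suc) (v∈C ∘ Fin.suc))
    where open IsLinearCode linear

  linComb-cong : ∀ {r} s c {v v′ : Fin s → Word r} j → (∀ a → v a j ≡ v′ a j) →
                 linComb s c v j ≡ linComb s c v′ j
  linComb-cong zero    c j v≡v′ = refl
  linComb-cong (suc s) c j v≡v′ =
    cong₂ _⊕_ (cong (c Fin.zero ⊗_) (v≡v′ Fin.zero)) (linComb-cong s (c ∘ Fin.suc) j (v≡v′ ∘ Fin.suc))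

  linComb-zero : ∀ {r} s c {v : Fin s → Word r} j → (∀ a → v a j ≡ 0#) → linComb s c v j ≡ 0#
  linComb-zero zero    c j v≡0 = refl
  linComb-zero (suc s) c j v≡0 = begin
    (c Fin.zero ⊗ _) ⊕ linComb s (c ∘ Fin.suc) _ j  ≡⟨ cong₂ _⊕_ (cong (c Fin.zero ⊗_) (v≡0 Fin.zero))
                                                                 (linComb-zero s (c ∘ Fin.suc) j (v≡0 ∘ Fin.suc)) ⟩
    (c Fin.zero ⊗ 0#) ⊕ 0#                          ≡⟨ trans (+-identityʳ _) (zeroʳ _) ⟩
    0#                                              ∎
    where open ≡-Reasoning

  linComb-⊖ : ∀ {r} s c c′ (v : Fin s → Word r) j →
    linComb s (λ a → c a ⊖ c′ a) v j ≡ linComb s c v j ⊖ linComb s c′ v j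
  linComb-⊖ zero    c c′ v j = sym (⊖-self 0#)
  linComb-⊖ (suc s) c c′ v j = begin
    ((c₀ ⊖ c₀′) ⊗ x) ⊕ linComb s (λ a → cₛ a ⊖ cₛ′ a) vₛ j
      ≡⟨ cong₂ _⊕_ (distribʳ x c₀ ((⊝ 1#) ⊗ c₀′)) (linComb-⊖ s cₛ cₛ′ vₛ j) ⟩
    ((c₀ ⊗ x) ⊕ (((⊝ 1#) ⊗ c₀′) ⊗ x)) ⊕ (L ⊖ L′)
      ≡⟨ cong (λ t → ((c₀ ⊗ x) ⊕ t) ⊕ (L ⊖ L′)) (*-assoc (⊝ 1#) c₀′ x) ⟩
    ((c₀ ⊗ x) ⊕ ((⊝ 1#) ⊗ (c₀′ ⊗ x))) ⊕ (L ⊕ ((⊝ 1#) ⊗ L′))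
      ≡⟨ interchange (c₀ ⊗ x) _ L _ ⟩
    ((c₀ ⊗ x) ⊕ L) ⊕ (((⊝ 1#) ⊗ (c₀′ ⊗ x)) ⊕ ((⊝ 1#) ⊗ L′))
      ≡⟨ cong (((c₀ ⊗ x) ⊕ L) ⊕_) (sym (distribˡ (⊝ 1#) (c₀′ ⊗ x) L′)) ⟩
    ((c₀ ⊗ x) ⊕ L) ⊖ ((c₀′ ⊗ x) ⊕ L′)
      ∎
    where
    open ≡-Reasoning
    c₀ = c Fin.zero
    c₀′ = c′ Fin.zero
    cₛ = c ∘ Fin.suc
    cₛ′ = c′ ∘ Fin.suc
    vₛ = v ∘ Fin.suc
    x = v Fin.zero j
    L = linComb s cₛ vₛ j
    L′ = linComb s cₛ′ vₛ j

  unitWord : ∀ {s} → Fin s → Word s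
  unitWord Fin.zero    Fin.zero    = 1#
  unitWord Fin.zero    (Fin.suc _) = 0#
  unitWord (Fin.suc _) Fin.zero    = 0#
  unitWord (Fin.suc a) (Fin.suc b) = unitWord a b

  linComb-unitWord : ∀ {r} s c {v : Fin s → Word r} j a → (∀ a′ → v a′ j ≡ unitWord a′ a) →
                     linComb s c v j ≡ c a
  linComb-unitWord (suc s) c j Fin.zero v≡unit =
    trans (cong₂ _⊕_ (trans (cong (c Fin.zero ⊗_) (v≡unit Fin.zero)) (*-identityʳ _))
                     (linComb-zero s (c ∘ Fin.suc) j (v≡unit ∘ Fin.suc)))
          (+-identityʳ _)
  linComb-unitWord (suc s) c j (Fin.suc a) v≡unit =
    trans (cong₂ _⊕_ (trans (cong (c Fin.zero ⊗_) (v≡unit Fin.zero)) (zeroʳ _))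
                     (linComb-unitWord s (c ∘ Fin.suc) j a (v≡unit ∘ Fin.suc)))
          (+-identityˡ _)

-- Systematic form of an MDS code

module Systematic {q : ℕ} (K : FiniteField q) {N d : ℕ} (1≤d : 1 ≤ d) (d≤N : d ≤ N)
                  {C : Codes.Word K N → Set} (mds : Codes.IsMDSCode K N d C) where
  open FiniteField K
  open Codes K
  open Linear K
  open IsMDSCode mds

  k : ℕ
  k = N ∸ d + 1

  open Split (mds-dimension≤length 1≤d d≤N) public

  vanishing-on-head⇒zero : ∀ {z} → C z → (∀ a → z (head a) ≡ 0#) → IsZeroW z
  vanishing-on-head⇒zero {z} z∈C z∘head≡0 with all? (λ j → z j ≟ 0#)
  ... | yes z≡0 = z≡0
  ... | no  z≢0 = contradiction (≤-trans (proj₁ minDist z z∈C z≢0) weight≤N-k)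
                                (<⇒≱ (mds-redundancy<d 1≤d d≤N))
    where
    weight≤N-k : weight z ≤ N ∸ k
    weight≤N-k = countFin-≤-∸ N k _ λ j j<k →
      cong not (dec-true (z j ≟ 0#) (subst (λ t → z t ≡ 0#) (head-fromℕ< j<k) (z∘head≡0 _)))

  agree-on-head⇒≗ : ∀ {x y} → C x → C y → (∀ a → x (head a) ≡ y (head a)) → ∀ j → x j ≡ y j
  agree-on-head⇒≗ {x} {y} x∈C y∈C on-head j = ⊖≡0⇒≡ (vanishing-on-head⇒zero
    (⊖-closed linear x∈C y∈C) (λ a → trans (cong (x (head a) ⊖_) (sym (on-head a))) (⊖-self _)) j)

  private
    basis : Fin k → Word N
    basis = proj₁ dim

    basis∈C : ∀ a → C (basis a)
    basis∈C = proj₁ (proj₂ dim)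

    independent : ∀ c → IsZeroW (linComb k c basis) → ∀ a → c a ≡ 0#
    independent = proj₁ (proj₂ (proj₂ dim))

    headOfCombination : Word k → Word k
    headOfCombination c a = linComb k c basis (head a)

    headOfCombination-injective : ∀ {c c′} → (∀ a → headOfCombination c a ≡ headOfCombination c′ a) →
                                  ∀ a → c a ≡ c′ a
    headOfCombination-injective {c} {c′} same-head a = ⊖≡0⇒≡ (independent _ difference≡0 a)
      where
      same : ∀ j → linComb k c basis j ≡ linComb k c′ basis j
      same = agree-on-head⇒≗ (linComb-closed linear k c basis basis∈C)
                             (linComb-closed linear k c′ basis basis∈C) same-head

      difference≡0 : IsZeroW (linComb k (λ a → c a ⊖ c′ a) basis)
      difference≡0 j = trans (linComb-⊖ k c c′ basis j)
                             (trans (cong (linComb k c basis j ⊖_) (sym (same j))) (⊖-self _))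

  codeword-with-head : ∀ u → ∃ λ x → C x × ∀ a → x (head a) ≡ u a
  codeword-with-head u =
    let c , hit = word-injective⇒surjective headOfCombination headOfCombination-injective u
    in linComb k c basis , linComb-closed linear k c basis basis∈C , hit

  systematicBasis : Fin k → Word N
  systematicBasis a = proj₁ (codeword-with-head (unitWord a))

  systematicBasis∈C : ∀ a → C (systematicBasis a)
  systematicBasis∈C a = proj₁ (proj₂ (codeword-with-head (unitWord a)))

  systematicBasis-head : ∀ a a′ → systematicBasis a (head a′) ≡ unitWord a a′
  systematicBasis-head a = proj₂ (proj₂ (codeword-with-head (unitWord a)))

  ≗-combination-of-systematicBasis : ∀ {x} → C x →
    ∀ j → x j ≡ linComb k (x ∘ head) systematicBasis j
  ≗-combination-of-systematicBasis {x} x∈C = agree-on-head⇒≗ x∈C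
    (linComb-closed linear k (x ∘ head) systematicBasis systematicBasis∈C)
    (λ a → sym (linComb-unitWord k (x ∘ head) (head a) a (λ a′ → systematicBasis-head a′ a)))

  -- The tail T of the systematic generator matrix [I_k | T].
  signature : Fin ((q ^ (N ∸ k)) ^ k)
  signature = funToFin (λ a → encodeWord (systematicBasis a ∘ tail))

sameSignature⇒⊆ : ∀ {q} (K : FiniteField q) {N d} (1≤d : 1 ≤ d) (d≤N : d ≤ N)
  {C C′ : Codes.Word K N → Set} (mds : Codes.IsMDSCode K N d C) (mds′ : Codes.IsMDSCode K N d C′) →
  Systematic.signature K 1≤d d≤N mds ≡ Systematic.signature K 1≤d d≤N mds′ →
  Linear._⊆ᶜ_ K C C′
sameSignature⇒⊆ K 1≤d d≤N mds mds′ same {x} x∈C =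
  linComb k (x ∘ head) B′.systematicBasis ,
  linComb-closed (IsMDSCode.linear mds′) k _ _ B′.systematicBasis∈C ,
  λ j → trans (B.≗-combination-of-systematicBasis x∈C j)
              (linComb-cong k (x ∘ head) j (λ a → same-basis a j))
  where
  open Codes K
  open Linear K
  module B = Systematic K 1≤d d≤N mds
  module B′ = Systematic K 1≤d d≤N mds′
  open B using (k; head; tail; agree-on-head-and-tail)

  same-basis : ∀ a j → B.systematicBasis a j ≡ B′.systematicBasis a j
  same-basis a = agree-on-head-and-tail
    (λ a′ → trans (B.systematicBasis-head a a′) (sym (B′.systematicBasis-head a a′)))
    (encodeWord-injective (funToFin-injective same a))

-- Counting MC(F,d)

module Counting {q : ℕ} (K : FiniteField q) {n m : ℕ} (F : Diagram n m) (d : ℕ) (1≤d : 1 ≤ d) where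
  open Codes K
  open Linear K using (_⊆ᶜ_; field-size≥2)
  open MCDef K F d

  InI? : ∀ i → Dec (InI F d i)
  InI? i = (1 ≤? i) ×-dec ((i ≤? m) ×-dec (d ≤? diagSize F i))

  systematicCount : ℕ → ℕ
  systematicCount N = (q ^ (N ∸ (N ∸ d + 1))) ^ (N ∸ d + 1)

  signatureSize : ℕ → ℕ
  signatureSize i = if does (InI? i) then systematicCount (diagSize F i) else 1

  signatureAt : ∀ {S} → InMC S → ∀ i (i∈I? : Dec (InI F d i)) →
                Fin (if does i∈I? then systematicCount (diagSize F i) else 1)
  signatureAt (_ , mds , _) i (yes i∈I) = Systematic.signature K 1≤d (proj₂ (proj₂ i∈I)) (mds i i∈I)
  signatureAt _             i (no _)    = Fin.zero

  signature : ∀ {S} → InMC S → Fin (prodTo m signatureSize)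
  signature w = combineTo m (λ i → signatureAt w i (InI? i))

  sameSignatureAt⇒⊆ : ∀ {S S′} (w : InMC S) (w′ : InMC S′) i (i∈I? : Dec (InI F d i)) →
    signatureAt w i i∈I? ≡ signatureAt w′ i i∈I? → InI F d i → proj₁ w i ⊆ᶜ proj₁ w′ i
  sameSignatureAt⇒⊆ (_ , mds , _) (_ , mds′ , _) i (yes i∈I) same _ =
    sameSignature⇒⊆ K 1≤d (proj₂ (proj₂ i∈I)) (mds i i∈I) (mds′ i i∈I) same
  sameSignatureAt⇒⊆ _ _ i (no i∉I) _ i∈I = contradiction i∈I i∉I

  ⊆⇒⊆-space : ∀ {S S′} (w : InMC S) (w′ : InMC S′) →
    (∀ i → InI F d i → proj₁ w i ⊆ᶜ proj₁ w′ i) →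
    ∀ M → S M → S′ M
  ⊆⇒⊆-space (C , _ , S-spanned) (C′ , _ , S′-spanned) C⊆C′ M M∈S =
    proj₂ (S′-spanned M) (x′ , x′∈C′ , placed′)
    where
    x : Words
    x = proj₁ (proj₁ (S-spanned M) M∈S)
    x∈C : ∀ i → InI F d i → C i (x i)
    x∈C = proj₁ (proj₂ (proj₁ (S-spanned M) M∈S))
    placed : Placed x M
    placed = proj₂ (proj₂ (proj₁ (S-spanned M) M∈S))

    transportAt : ∀ i → Dec (InI F d i) →
      Σ (Word (diagSize F i)) λ y → (InI F d i → C′ i y) × ∀ j → x i j ≡ y j
    transportAt i (yes i∈I) = let y , y∈C′ , x≗y = C⊆C′ i i∈I (x∈C i i∈I) in y , (λ _ → y∈C′) , x≗y
    transportAt i (no i∉I)  = x i , (λ i∈I → contradiction i∈I i∉I) , (λ _ → refl)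

    x′ : Words
    x′ i = proj₁ (transportAt i (InI? i))
    x′∈C′ : ∀ i → InI F d i → C′ i (x′ i)
    x′∈C′ i = proj₁ (proj₂ (transportAt i (InI? i)))
    placed′ : Placed x′ M
    placed′ a b = (λ Fab i∈I r r≡rank → trans (proj₁ (placed a b) Fab i∈I r r≡rank)
                                              (proj₂ (proj₂ (transportAt _ (InI? _))) r))
                , proj₂ (placed a b)

  sameSignature⇒SameSpace : ∀ {S S′} (w : InMC S) (w′ : InMC S′) →
                            signature w ≡ signature w′ → SameSpace S S′
  sameSignature⇒SameSpace w w′ same M =
    ⊆⇒⊆-space w w′ (λ i i∈I → sameSignatureAt⇒⊆ w w′ i (InI? i) (sameAt same i∈I) i∈I) M ,
    ⊆⇒⊆-space w′ w (λ i i∈I → sameSignatureAt⇒⊆ w′ w i (InI? i) (sameAt (sym same) i∈I) i∈I) M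
    where
    sameAt : ∀ {S S′} {w : InMC S} {w′ : InMC S′} → signature w ≡ signature w′ →
             ∀ {i} → InI F d i → signatureAt w i (InI? i) ≡ signatureAt w′ i (InI? i)
    sameAt e (1≤i , i≤m , _) = combineTo-injective m e 1≤i i≤m

  cardMC≤signatureCount : CardMC≤ (prodTo m signatureSize)
  cardMC≤signatureCount _ = pairwiseUnrelated⇒length≤ signature sameSignature⇒SameSpace

  signatureCount≤mcBound : prodTo m signatureSize ≤ mcBound F q d
  signatureCount≤mcBound = prodTo-mono-≤ m (λ i → factor≤ i (InI? i))
    where
    systematicCount≤qBinom : ∀ {N} → d ≤ N → systematicCount N ≤ qBinom q N (N ∸ d + 1)
    systematicCount≤qBinom {N} d≤N =
      qBinom-lower-bound q N (N ∸ d + 1) field-size≥2 (mds-dimension≤length 1≤d d≤N)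

    systematicCount>0 : ∀ N → 0 < systematicCount N
    systematicCount>0 N = [m^n]^o>0 q (N ∸ (N ∸ d + 1)) (N ∸ d + 1) (≤-trans (s≤s z≤n) field-size≥2)

    factor≤ : ∀ i (i∈I? : Dec (InI F d i)) →
      (if does i∈I? then systematicCount (diagSize F i) else 1) ≤
      (if d ≤ᵇ diagSize F i then qBinom q (diagSize F i) (diagSize F i ∸ d + 1) else 1)
    factor≤ i i∈I? with i∈I? | d ≤ᵇ diagSize F i in d≤ᵇN
    ... | yes (_ , _ , d≤N) | true  = systematicCount≤qBinom d≤N
    ... | yes (_ , _ , d≤N) | false = contradiction (≤⇒≤ᵇ d≤N) (subst T d≤ᵇN)
    ... | no _              | true  = ≤-trans (systematicCount>0 (diagSize F i))
                                        (systematicCount≤qBinom (≤ᵇ⇒≤ d _ (subst T (sym d≤ᵇN) _)))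
    ... | no _              | false = ≤-refl

proposition4p4 : (q : ℕ) → IsPrimePower q → (K : FiniteField q) →
    (n m : ℕ) → (F : Diagram n m) → IsFerrers n m F → n ≤ m →
    (d : ℕ) → 2 ≤ d → d ≤ n → IsMDSConstructible F d →
    MCDef.CardMC≤ K F d (mcBound F q d)
proposition4p4 q _ K n m F _ _ d 2≤d _ _ Ss Ss∈MC distinct =
  ≤-trans (cardMC≤signatureCount Ss Ss∈MC distinct) signatureCount≤mcBound
  where open Counting K F d (≤-trans (s≤s z≤n) 2≤d)
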